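{- For every positive integer $k$, \[ B_{2k}=\frac{k}{2(2^{2k}-1)}\Biggl[1-\sum_{j=1}^{k-1}\binom{2k-1}{2j-1} \frac{2^{2j}-1}{j}B_{2j}\Biggr]. \]
   Context: The Bernoulli numbers $B_n$ are defined by $\frac{z}{e^z-1}=\sum_{n=0}^\infty B_n\frac{z^n}{n!}$ for $|z|<2\pi$. An empty sum is $0$. -}

module Defs where

open import Data.Nat as ℕ using (ℕ; zero; suc)
open import Data.Nat.Combinatorics using (_C_)
open import Data.Integer using (+_)
open import Data.List using (List; []; _∷_; reverse; zipWith; upTo; foldr)
open import Data.Rational using (ℚ; 0ℚ; 1ℚ; _+_; _*_; -_; _/_)

ℕ→ℚ : ℕ → ℚ
ℕ→ℚ n = (+ n) / 1

-- division of a rational by a natural number (only used with nonzero divisors;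
-- the value at divisor 0 is irrelevant, set to 0)
_/ℕ_ : ℚ → ℕ → ℚ
q /ℕ zero = 0ℚ
q /ℕ suc d = q * ((+ 1) / suc d)

Σ[1‥_] : ℕ → (ℕ → ℚ) → ℚ
Σ[1‥ zero ] f = 0ℚ
Σ[1‥ suc n ] f = Σ[1‥ n ] f + f (suc n)

-- Bernoulli numbers (convention B₁ = -1/2, matching z/(e^z-1)), via the
-- recurrence equivalent to the generating function:
--   B₀ = 1,   Σ_{j=0}^{n} C(n+1,j) B_j = 0 for n ≥ 1.
-- bernNext n bs computes B_n from bs = [B_0, …, B_{n-1}].
bernNext : ℕ → List ℚ → ℚ
bernNext zero bs = 1ℚ
bernNext (suc m) bs =
  - ((foldr _+_ 0ℚ (zipWith (λ j b → ℕ→ℚ (suc (suc m) C j) * b) (upTo (suc m)) bs))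
       /ℕ suc (suc m))

bernList : ℕ → List ℚ
bernList zero = []
bernList (suc n) = reverse (bernNext n (bernList n) ∷ reverse (bernList n))

bernoulli : ℕ → ℚ
bernoulli n = bernNext n (bernList n)

-- Let B(z) = z / (e^z - 1) = Σ Bₙ zⁿ / n!, computed in the ring of exponential generating
-- functions, where e^z - 1 can be cancelled. Since e^{2z} - 1 = (e^z - 1)(e^z + 1), the series
-- D(z) = B(z) - B(2z) satisfies D(z) (e^z + 1) = z; on coefficients,
-- Σ_{i<n} (n C i)(1 - 2ⁱ) Bᵢ + 2 (1 - 2ⁿ) Bₙ = [n = 1]. At n = 2k the odd terms vanish except
-- i = 1, which contributes k, because B(-z) = z + B(z); the absorption identity
-- j (2k C 2j) = k (2k-1 C 2j-1) turns the even terms into -k times the summands of the theorem,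
-- and solving for B_{2k} gives the formula.

module Submission where

open import Defs
open import Data.Nat as ℕ using (ℕ; _≤_; _∸_; _^_)
open import Data.Nat.Combinatorics using (_C_)
open import Data.Rational using (ℚ; 1ℚ; _*_; _-_)
open import Relation.Binary.PropositionalEquality using (_≡_)

open import Algebra.Bundles using (CommutativeRing; CommutativeMonoid)
import Algebra.Properties.CommutativeSemigroup as CommutativeSemigroupProperties
import Algebra.Construct.Pointwise as Pointwise
import Algebra.Solver.Ring
open import Algebra.Solver.Ring.AlmostCommutativeRing
  using (fromCommutativeRing; _-Raw-AlmostCommutative⟶_)
import Data.Integer as ℤ
import Data.Integer.Properties as ℤₚ
open import Data.List using (zipWith; upTo; foldr; applyUpTo; _∷_; _∷ʳ_; reverse)
import Data.List.Properties as Listₚ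
open import Data.Maybe using (Maybe; just; nothing)
open import Data.Nat using (zero; suc; _<_; NonZero; >-nonZero)
open import Data.Nat.Combinatorics
  using (nCk+nC[k+1]≡[n+1]C[k+1]; nCn≡1; nC1≡n; k>n⇒nCk≡0; nCk≡nC[n∸k])
open import Data.Nat.Induction using (<-rec)
import Data.Nat.Properties as ℕₚ
import Data.Nat.Solver as NatSolver
open import Data.Product using (_,_)
open import Data.Rational using (0ℚ; _+_; -_; _/_; toℚᵘ; +-*-rawRing; +-*-rawSemiring)
open import Data.Rational.Properties
import Data.Rational.Unnormalised as ℚᵘ
import Data.Rational.Unnormalised.Properties as ℚᵘₚ
open import Data.Rational.Solver using (module +-*-Solver)
open import Function using (_∘_)
open import Relation.Binary.PropositionalEquality
  using (refl; sym; trans; cong; cong₂; module ≡-Reasoning)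
open import Relation.Nullary using (yes; no)
import Relation.Binary.Reasoning.Setoid

open import Algebra.Definitions.RawSemiring +-*-rawSemiring using () renaming (_^_ to _^ℚ_)
module +-CS = CommutativeSemigroupProperties (CommutativeMonoid.commutativeSemigroup +-0-commutativeMonoid)
module *-CS = CommutativeSemigroupProperties (CommutativeMonoid.commutativeSemigroup *-1-commutativeMonoid)
open import Algebra.Properties.Group +-0-group using (identityˡ-unique; x∙y⁻¹≈ε⇒x≈y)

toℚᵘ-ℕ→ℚ : ∀ n → toℚᵘ (ℕ→ℚ n) ℚᵘ.≃ ℚᵘ.mkℚᵘ (ℤ.+ n) 0
toℚᵘ-ℕ→ℚ n = toℚᵘ-fromℚᵘ (ℚᵘ.mkℚᵘ (ℤ.+ n) 0)

ℕ→ℚ-+ : ∀ m n → ℕ→ℚ (m ℕ.+ n) ≡ ℕ→ℚ m + ℕ→ℚ n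
ℕ→ℚ-+ m n = toℚᵘ-injective (begin
  toℚᵘ (ℕ→ℚ (m ℕ.+ n))                          ≈⟨ toℚᵘ-ℕ→ℚ (m ℕ.+ n) ⟩
  ℚᵘ.mkℚᵘ (ℤ.+ (m ℕ.+ n)) 0                     ≈⟨ ℚᵘ.*≡* (cong (ℤ._* ℤ.+ 1) (sym numerators)) ⟩
  ℚᵘ.mkℚᵘ (ℤ.+ m) 0 ℚᵘ.+ ℚᵘ.mkℚᵘ (ℤ.+ n) 0      ≈⟨ ℚᵘₚ.+-cong (toℚᵘ-ℕ→ℚ m) (toℚᵘ-ℕ→ℚ n) ⟨
  toℚᵘ (ℕ→ℚ m) ℚᵘ.+ toℚᵘ (ℕ→ℚ n)               ≈⟨ toℚᵘ-homo-+ (ℕ→ℚ m) (ℕ→ℚ n) ⟨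
  toℚᵘ (ℕ→ℚ m + ℕ→ℚ n)                          ∎)
  where
  open ℚᵘₚ.≃-Reasoning
  numerators : ℤ.+ m ℤ.* ℤ.+ 1 ℤ.+ ℤ.+ n ℤ.* ℤ.+ 1 ≡ ℤ.+ (m ℕ.+ n)
  numerators = cong₂ ℤ._+_ (ℤₚ.*-identityʳ (ℤ.+ m)) (ℤₚ.*-identityʳ (ℤ.+ n))

ℕ→ℚ-* : ∀ m n → ℕ→ℚ (m ℕ.* n) ≡ ℕ→ℚ m * ℕ→ℚ n
ℕ→ℚ-* m n = toℚᵘ-injective (begin
  toℚᵘ (ℕ→ℚ (m ℕ.* n))                          ≈⟨ toℚᵘ-ℕ→ℚ (m ℕ.* n) ⟩
  ℚᵘ.mkℚᵘ (ℤ.+ (m ℕ.* n)) 0                     ≈⟨ ℚᵘ.*≡* (cong (ℤ._* ℤ.+ 1) (ℤₚ.pos-* m n)) ⟩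
  ℚᵘ.mkℚᵘ (ℤ.+ m) 0 ℚᵘ.* ℚᵘ.mkℚᵘ (ℤ.+ n) 0      ≈⟨ ℚᵘₚ.*-cong (toℚᵘ-ℕ→ℚ m) (toℚᵘ-ℕ→ℚ n) ⟨
  toℚᵘ (ℕ→ℚ m) ℚᵘ.* toℚᵘ (ℕ→ℚ n)               ≈⟨ toℚᵘ-homo-* (ℕ→ℚ m) (ℕ→ℚ n) ⟨
  toℚᵘ (ℕ→ℚ m * ℕ→ℚ n)                          ∎)
  where open ℚᵘₚ.≃-Reasoning

ℕ→ℚ-*-inverse : ∀ d → ℕ→ℚ (suc d) * (ℤ.+ 1 / suc d) ≡ 1ℚ
ℕ→ℚ-*-inverse d = toℚᵘ-injective (begin
  toℚᵘ (ℕ→ℚ (suc d) * (ℤ.+ 1 / suc d))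
    ≈⟨ toℚᵘ-homo-* (ℕ→ℚ (suc d)) (ℤ.+ 1 / suc d) ⟩
  toℚᵘ (ℕ→ℚ (suc d)) ℚᵘ.* toℚᵘ (ℤ.+ 1 / suc d)
    ≈⟨ ℚᵘₚ.*-cong (toℚᵘ-ℕ→ℚ (suc d)) (toℚᵘ-fromℚᵘ (ℚᵘ.mkℚᵘ (ℤ.+ 1) d)) ⟩
  ℚᵘ.mkℚᵘ (ℤ.+ suc d) 0 ℚᵘ.* ℚᵘ.mkℚᵘ (ℤ.+ 1) d
    ≈⟨ ℚᵘ.*≡* (cong ℤ.+_ cross-products) ⟩
  toℚᵘ 1ℚ ∎)
  where
  open ℚᵘₚ.≃-Reasoning
  cross-products : (suc d ℕ.* 1) ℕ.* 1 ≡ 1 ℕ.* (1 ℕ.* suc d)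
  cross-products = trans (ℕₚ.*-identityʳ (suc d ℕ.* 1)) (trans (ℕₚ.*-identityʳ (suc d))
    (sym (trans (ℕₚ.*-identityˡ (1 ℕ.* suc d)) (ℕₚ.*-identityˡ (suc d)))))

ℕ→ℚ-∸ : ∀ {m n} → n ≤ m → ℕ→ℚ (m ∸ n) ≡ ℕ→ℚ m - ℕ→ℚ n
ℕ→ℚ-∸ {m} {n} n≤m = begin
  ℕ→ℚ (m ∸ n)                          ≡⟨ solve 2 (λ x y → x := (x :+ y) :- y) refl (ℕ→ℚ (m ∸ n)) (ℕ→ℚ n) ⟩
  (ℕ→ℚ (m ∸ n) + ℕ→ℚ n) - ℕ→ℚ n       ≡⟨ cong (_- ℕ→ℚ n) (sym (ℕ→ℚ-+ (m ∸ n) n)) ⟩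
  ℕ→ℚ (m ∸ n ℕ.+ n) - ℕ→ℚ n            ≡⟨ cong (λ x → ℕ→ℚ x - ℕ→ℚ n) (ℕₚ.m∸n+n≡m n≤m) ⟩
  ℕ→ℚ m - ℕ→ℚ n                        ∎
  where
  open ≡-Reasoning
  open +-*-Solver

ℕ→ℚ-^ : ∀ m n → ℕ→ℚ (m ^ n) ≡ ℕ→ℚ m ^ℚ n
ℕ→ℚ-^ m zero    = refl
ℕ→ℚ-^ m (suc n) = trans (ℕ→ℚ-* m (m ^ n)) (cong (ℕ→ℚ m *_) (ℕ→ℚ-^ m n))

ℕ→ℚ-2^n∸1 : ∀ n → ℕ→ℚ (2 ^ n ∸ 1) ≡ ℕ→ℚ 2 ^ℚ n - 1ℚ
ℕ→ℚ-2^n∸1 n = trans (ℕ→ℚ-∸ (ℕₚ.m^n>0 2 n)) (cong (_- 1ℚ) (ℕ→ℚ-^ 2 n))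

ℕ→ℚ-*-/ℕ : ∀ d .{{_ : NonZero d}} q → ℕ→ℚ d * (q /ℕ d) ≡ q
ℕ→ℚ-*-/ℕ (suc d) q = begin
  ℕ→ℚ (suc d) * (q * (ℤ.+ 1 / suc d))   ≡⟨ *-CS.x∙yz≈y∙xz (ℕ→ℚ (suc d)) q (ℤ.+ 1 / suc d) ⟩
  q * (ℕ→ℚ (suc d) * (ℤ.+ 1 / suc d))   ≡⟨ cong (q *_) (ℕ→ℚ-*-inverse d) ⟩
  q * 1ℚ                                ≡⟨ *-identityʳ q ⟩
  q                                     ∎
  where open ≡-Reasoning

/ℕ-unique : ∀ d .{{_ : NonZero d}} {q x} → ℕ→ℚ d * x ≡ q → x ≡ q /ℕ d
/ℕ-unique (suc d) {q} {x} dx≡q = begin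
  x                                     ≡⟨ *-identityʳ x ⟨
  x * 1ℚ                                ≡⟨ cong (x *_) (ℕ→ℚ-*-inverse d) ⟨
  x * (ℕ→ℚ (suc d) * (ℤ.+ 1 / suc d))   ≡⟨ *-CS.x∙yz≈yx∙z x (ℕ→ℚ (suc d)) (ℤ.+ 1 / suc d) ⟩
  (ℕ→ℚ (suc d) * x) * (ℤ.+ 1 / suc d)   ≡⟨ cong (_* (ℤ.+ 1 / suc d)) dx≡q ⟩
  q /ℕ suc d                            ∎
  where open ≡-Reasoning

*-/ℕ : ∀ d .{{_ : NonZero d}} q y → (q * y) /ℕ d ≡ (q /ℕ d) * y
*-/ℕ (suc d) q y = *-CS.xy∙z≈xz∙y q y (ℤ.+ 1 / suc d)

-x≡x⇒x≡0 : ∀ x → - x ≡ x → x ≡ 0ℚ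
-x≡x⇒x≡0 x -x≡x = trans (/ℕ-unique 2 2x≡0) (*-zeroˡ (ℤ.+ 1 / 2))
  where
  open +-*-Solver
  2x≡0 : ℕ→ℚ 2 * x ≡ 0ℚ
  2x≡0 = begin
    ℕ→ℚ 2 * x  ≡⟨ solve 1 (λ x → con (ℕ→ℚ 2) :* x := x :+ x) refl x ⟩
    x + x      ≡⟨ cong (x +_) -x≡x ⟨
    x + - x    ≡⟨ +-inverseʳ x ⟩
    0ℚ         ∎
    where open ≡-Reasoning

[-1]^[2n]≡1 : ∀ n → (- 1ℚ) ^ℚ (2 ℕ.* n) ≡ 1ℚ
[-1]^[2n]≡1 zero    = refl
[-1]^[2n]≡1 (suc n) = begin
  (- 1ℚ) ^ℚ (2 ℕ.* suc n)                ≡⟨ cong ((- 1ℚ) ^ℚ_) (ℕₚ.*-suc 2 n) ⟩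
  - 1ℚ * (- 1ℚ * (- 1ℚ) ^ℚ (2 ℕ.* n))    ≡⟨ cong (λ x → - 1ℚ * (- 1ℚ * x)) ([-1]^[2n]≡1 n) ⟩
  1ℚ                                     ∎
  where open ≡-Reasoning

Σ[<_] : ℕ → (ℕ → ℚ) → ℚ
Σ[< zero  ] f = 0ℚ
Σ[< suc n ] f = Σ[< n ] f + f n

Σ[<]-cong : ∀ n {f g} → (∀ j → f j ≡ g j) → Σ[< n ] f ≡ Σ[< n ] g
Σ[<]-cong zero    f≗g = refl
Σ[<]-cong (suc n) f≗g = cong₂ _+_ (Σ[<]-cong n f≗g) (f≗g n)

Σ[<]-zero : ∀ n {f} → (∀ j → j < n → f j ≡ 0ℚ) → Σ[< n ] f ≡ 0ℚ
Σ[<]-zero zero    f≡0 = refl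
Σ[<]-zero (suc n) f≡0 =
  cong₂ _+_ (Σ[<]-zero n (λ j j<n → f≡0 j (ℕₚ.m<n⇒m<1+n j<n))) (f≡0 n (ℕₚ.n<1+n n))

Σ[<]-+ : ∀ n f g → Σ[< n ] (λ j → f j + g j) ≡ Σ[< n ] f + Σ[< n ] g
Σ[<]-+ zero    f g = refl
Σ[<]-+ (suc n) f g =
  trans (cong (_+ (f n + g n)) (Σ[<]-+ n f g)) (+-CS.interchange (Σ[< n ] f) (Σ[< n ] g) (f n) (g n))

Σ[<]-*-distribˡ : ∀ n c f → Σ[< n ] (λ j → c * f j) ≡ c * Σ[< n ] f
Σ[<]-*-distribˡ zero    c f = sym (*-zeroʳ c)
Σ[<]-*-distribˡ (suc n) c f =
  trans (cong (_+ c * f n) (Σ[<]-*-distribˡ n c f)) (sym (*-distribˡ-+ c (Σ[< n ] f) (f n)))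

Σ[<]-shift : ∀ n f → Σ[< suc n ] f ≡ f 0 + Σ[< n ] (f ∘ suc)
Σ[<]-shift zero    f = trans (+-identityˡ (f 0)) (sym (+-identityʳ (f 0)))
Σ[<]-shift (suc n) f = trans (cong (_+ f (suc n)) (Σ[<]-shift n f)) (+-assoc (f 0) _ (f (suc n)))

Σ[<]-pairs : ∀ n f → Σ[< 2 ℕ.* n ] f ≡ Σ[< n ] (λ i → f (2 ℕ.* i) + f (suc (2 ℕ.* i)))
Σ[<]-pairs zero    f = refl
Σ[<]-pairs (suc n) f = begin
  Σ[< 2 ℕ.* suc n ] f                                 ≡⟨ cong (λ m → Σ[< m ] f) (ℕₚ.*-suc 2 n) ⟩
  Σ[< 2 ℕ.* n ] f + f (2 ℕ.* n) + f (suc (2 ℕ.* n))   ≡⟨ +-assoc (Σ[< 2 ℕ.* n ] f) _ _ ⟩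
  Σ[< 2 ℕ.* n ] f + (f (2 ℕ.* n) + f (suc (2 ℕ.* n))) ≡⟨ cong (_+ (f (2 ℕ.* n) + f (suc (2 ℕ.* n)))) (Σ[<]-pairs n f) ⟩
  Σ[< suc n ] (λ i → f (2 ℕ.* i) + f (suc (2 ℕ.* i))) ∎
  where open ≡-Reasoning

Σ[1‥]≡Σ[<] : ∀ n f → Σ[1‥ n ] f ≡ Σ[< n ] (f ∘ suc)
Σ[1‥]≡Σ[<] zero    f = refl
Σ[1‥]≡Σ[<] (suc n) f = cong (_+ f (suc n)) (Σ[1‥]≡Σ[<] n f)

zipWith-applyUpTo : ∀ {A B C : Set} (f : A → B → C) g h n →
  zipWith f (applyUpTo g n) (applyUpTo h n) ≡ applyUpTo (λ j → f (g j) (h j)) n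
zipWith-applyUpTo f g h zero    = refl
zipWith-applyUpTo f g h (suc n) = cong (f (g 0) (h 0) ∷_) (zipWith-applyUpTo f (g ∘ suc) (h ∘ suc) n)

foldr-+-applyUpTo : ∀ g n → foldr _+_ 0ℚ (applyUpTo g n) ≡ Σ[< n ] g
foldr-+-applyUpTo g zero    = refl
foldr-+-applyUpTo g (suc n) =
  trans (cong (g 0 +_) (foldr-+-applyUpTo (g ∘ suc) n)) (sym (Σ[<]-shift n g))

[k+1]*[n+1]C[k+1]≡[n+1]*nCk : ∀ n k → suc k ℕ.* (suc n C suc k) ≡ suc n ℕ.* (n C k)
[k+1]*[n+1]C[k+1]≡[n+1]*nCk zero    zero    = refl
[k+1]*[n+1]C[k+1]≡[n+1]*nCk zero    (suc k) = ℕₚ.*-zeroʳ (suc (suc k))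
[k+1]*[n+1]C[k+1]≡[n+1]*nCk (suc n) zero    =
  trans (ℕₚ.*-identityˡ (suc (suc n) C 1)) (trans (nC1≡n (suc (suc n))) (sym (ℕₚ.*-identityʳ (suc (suc n)))))
[k+1]*[n+1]C[k+1]≡[n+1]*nCk (suc n) (suc k) = begin
  suc (suc k) ℕ.* (suc (suc n) C suc (suc k))
    ≡⟨ cong (suc (suc k) ℕ.*_) (nCk+nC[k+1]≡[n+1]C[k+1] (suc n) (suc k)) ⟨
  suc (suc k) ℕ.* (x ℕ.+ y)
    ≡⟨ solve 3 (λ K X Y → (con 1 :+ K) :* (X :+ Y) := X :+ K :* X :+ (con 1 :+ K) :* Y) refl (suc k) x y ⟩
  x ℕ.+ suc k ℕ.* x ℕ.+ suc (suc k) ℕ.* y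
    ≡⟨ cong₂ (λ a b → x ℕ.+ a ℕ.+ b) ([k+1]*[n+1]C[k+1]≡[n+1]*nCk n k) ([k+1]*[n+1]C[k+1]≡[n+1]*nCk n (suc k)) ⟩
  x ℕ.+ suc n ℕ.* (n C k) ℕ.+ suc n ℕ.* (n C suc k)
    ≡⟨ solve 4 (λ X N a b → X :+ N :* a :+ N :* b := X :+ N :* (a :+ b)) refl x (suc n) (n C k) (n C suc k) ⟩
  x ℕ.+ suc n ℕ.* (n C k ℕ.+ n C suc k)
    ≡⟨ cong (λ z → x ℕ.+ suc n ℕ.* z) (nCk+nC[k+1]≡[n+1]C[k+1] n k) ⟩
  suc (suc n) ℕ.* x ∎
  where
  open ≡-Reasoning
  open NatSolver.+-*-Solver
  x = suc n C suc k
  y = suc n C suc (suc k)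

k*nCk≡n*[n-1]C[k-1] : ∀ n k → 1 ≤ k → k ℕ.* (n C k) ≡ n ℕ.* ((n ∸ 1) C (k ∸ 1))
k*nCk≡n*[n-1]C[k-1] zero    (suc k) _ = ℕₚ.*-zeroʳ (suc k)
k*nCk≡n*[n-1]C[k-1] (suc n) (suc k) _ = [k+1]*[n+1]C[k+1]≡[n+1]*nCk n k

[1+n]Cn≡1+n : ∀ n → suc n C n ≡ suc n
[1+n]Cn≡1+n n = begin
  suc n C n            ≡⟨ nCk≡nC[n∸k] (ℕₚ.n≤1+n n) ⟩
  suc n C (suc n ∸ n)  ≡⟨ cong (suc n C_) (ℕₚ.m+n∸n≡m 1 n) ⟩
  suc n C 1            ≡⟨ nC1≡n (suc n) ⟩
  suc n                ∎
  where open ≡-Reasoning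

j*[2k]C[2j]≡k*[2k-1]C[2j-1] : ∀ k j → 1 ≤ j → j ℕ.* ((2 ℕ.* k) C (2 ℕ.* j)) ≡ k ℕ.* ((2 ℕ.* k ∸ 1) C (2 ℕ.* j ∸ 1))
j*[2k]C[2j]≡k*[2k-1]C[2j-1] k j 1≤j = ℕₚ.*-cancelˡ-≡ _ _ 2 (begin
  2 ℕ.* (j ℕ.* c)          ≡⟨ ℕₚ.*-assoc 2 j c ⟨
  2 ℕ.* j ℕ.* c            ≡⟨ k*nCk≡n*[n-1]C[k-1] (2 ℕ.* k) (2 ℕ.* j) (ℕₚ.≤-trans 1≤j (ℕₚ.m≤n*m j 2)) ⟩
  2 ℕ.* k ℕ.* c′           ≡⟨ ℕₚ.*-assoc 2 k c′ ⟩
  2 ℕ.* (k ℕ.* c′)         ∎)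
  where
  open ≡-Reasoning
  c  = (2 ℕ.* k) C (2 ℕ.* j)
  c′ = (2 ℕ.* k ∸ 1) C (2 ℕ.* j ∸ 1)

-- Exponential generating functions

-- a : EGF stands for the exponential generating function Σₙ aₙ zⁿ / n!.
EGF : Set
EGF = ℕ → ℚ

infix  4 _≐_
infixl 6 _⊕_
infixl 7 _⊛_
infix  8 ⊖_

_≐_ : EGF → EGF → Set
a ≐ b = ∀ n → a n ≡ b n

_⊕_ : EGF → EGF → EGF
(a ⊕ b) n = a n + b n

⊖_ : EGF → EGF
(⊖ a) n = - a n

𝟘 : EGF
𝟘 _ = 0ℚ

cst : ℚ → EGF
cst q zero    = q
cst q (suc _) = 0ℚ

𝟙 : EGF
𝟙 = cst 1ℚ

X : EGF
X (suc zero) = 1ℚ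
X _          = 0ℚ

exp : EGF
exp _ = 1ℚ

∂ : EGF → EGF
∂ a n = a (suc n)

-- The product is determined by the Leibniz rule ∂ (a ⊛ b) = ∂ a ⊛ b + a ⊛ ∂ b;
-- coefficientwise it is the binomial convolution Σⱼ (n C j) aⱼ bₙ₋ⱼ.
_⊛_ : EGF → EGF → EGF
(a ⊛ b) zero    = a 0 * b 0
(a ⊛ b) (suc n) = (∂ a ⊛ b) n + (a ⊛ ∂ b) n

⊛-cong : ∀ {a a′ b b′} → a ≐ a′ → b ≐ b′ → a ⊛ b ≐ a′ ⊛ b′
⊛-cong a≐a′ b≐b′ zero    = cong₂ _*_ (a≐a′ 0) (b≐b′ 0)
⊛-cong a≐a′ b≐b′ (suc n) =
  cong₂ _+_ (⊛-cong (a≐a′ ∘ suc) b≐b′ n) (⊛-cong a≐a′ (b≐b′ ∘ suc) n)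

⊛-comm : ∀ a b → a ⊛ b ≐ b ⊛ a
⊛-comm a b zero    = *-comm (a 0) (b 0)
⊛-comm a b (suc n) =
  trans (cong₂ _+_ (⊛-comm (∂ a) b n) (⊛-comm a (∂ b) n)) (+-comm ((b ⊛ ∂ a) n) ((∂ b ⊛ a) n))

⊛-distribʳ : ∀ a b c → (a ⊕ b) ⊛ c ≐ a ⊛ c ⊕ b ⊛ c
⊛-distribʳ a b c zero    = *-distribʳ-+ (c 0) (a 0) (b 0)
⊛-distribʳ a b c (suc n) =
  trans (cong₂ _+_ (⊛-distribʳ (∂ a) (∂ b) c n) (⊛-distribʳ a b (∂ c) n))
        (+-CS.interchange ((∂ a ⊛ c) n) ((∂ b ⊛ c) n) ((a ⊛ ∂ c) n) ((b ⊛ ∂ c) n))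

⊛-distribˡ : ∀ a b c → a ⊛ (b ⊕ c) ≐ a ⊛ b ⊕ a ⊛ c
⊛-distribˡ a b c n = begin
  (a ⊛ (b ⊕ c)) n          ≡⟨ ⊛-comm a (b ⊕ c) n ⟩
  ((b ⊕ c) ⊛ a) n          ≡⟨ ⊛-distribʳ b c a n ⟩
  (b ⊛ a) n + (c ⊛ a) n    ≡⟨ cong₂ _+_ (⊛-comm b a n) (⊛-comm c a n) ⟩
  (a ⊛ b) n + (a ⊛ c) n    ∎
  where open ≡-Reasoning

⊛-zeroˡ : ∀ a → 𝟘 ⊛ a ≐ 𝟘
⊛-zeroˡ a zero    = *-zeroˡ (a 0)
⊛-zeroˡ a (suc n) = cong₂ _+_ (⊛-zeroˡ a n) (⊛-zeroˡ (∂ a) n)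

cst-⊛ : ∀ q a → cst q ⊛ a ≐ λ n → q * a n
cst-⊛ q a zero    = refl
cst-⊛ q a (suc n) = trans (cong₂ _+_ (⊛-zeroˡ a n) (cst-⊛ q (∂ a) n)) (+-identityˡ (q * a (suc n)))

⊛-identityˡ : ∀ a → 𝟙 ⊛ a ≐ a
⊛-identityˡ a n = trans (cst-⊛ 1ℚ a n) (*-identityˡ (a n))

⊛-assoc : ∀ a b c → (a ⊛ b) ⊛ c ≐ a ⊛ (b ⊛ c)
⊛-assoc a b c zero    = *-assoc (a 0) (b 0) (c 0)
⊛-assoc a b c (suc n) = begin
  (∂ (a ⊛ b) ⊛ c) n + ((a ⊛ b) ⊛ ∂ c) n
    ≡⟨ cong (_+ ((a ⊛ b) ⊛ ∂ c) n) (⊛-distribʳ (∂ a ⊛ b) (a ⊛ ∂ b) c n) ⟩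
  ((∂ a ⊛ b) ⊛ c) n + ((a ⊛ ∂ b) ⊛ c) n + ((a ⊛ b) ⊛ ∂ c) n
    ≡⟨ cong₂ _+_ (cong₂ _+_ (⊛-assoc (∂ a) b c n) (⊛-assoc a (∂ b) c n)) (⊛-assoc a b (∂ c) n) ⟩
  (∂ a ⊛ (b ⊛ c)) n + (a ⊛ (∂ b ⊛ c)) n + (a ⊛ (b ⊛ ∂ c)) n
    ≡⟨ +-assoc ((∂ a ⊛ (b ⊛ c)) n) ((a ⊛ (∂ b ⊛ c)) n) ((a ⊛ (b ⊛ ∂ c)) n) ⟩
  (∂ a ⊛ (b ⊛ c)) n + ((a ⊛ (∂ b ⊛ c)) n + (a ⊛ (b ⊛ ∂ c)) n)
    ≡⟨ cong ((∂ a ⊛ (b ⊛ c)) n +_) (⊛-distribˡ a (∂ b ⊛ c) (b ⊛ ∂ c) n) ⟨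
  (∂ a ⊛ (b ⊛ c)) n + (a ⊛ ∂ (b ⊛ c)) n ∎
  where open ≡-Reasoning

egf-commutativeRing : CommutativeRing _ _
egf-commutativeRing = record
  { Carrier = EGF
  ; _≈_     = _≐_
  ; _+_     = _⊕_
  ; _*_     = _⊛_
  ; -_      = ⊖_
  ; 0#      = 𝟘
  ; 1#      = 𝟙
  ; isCommutativeRing = record
    { isRing = record
      { +-isAbelianGroup = Pointwise.isAbelianGroup ℕ +-0-isAbelianGroup
      ; *-cong           = ⊛-cong
      ; *-assoc          = ⊛-assoc
      ; *-identity       = ⊛-identityˡ , λ a n → trans (⊛-comm a 𝟙 n) (⊛-identityˡ a n)
      ; distrib          = ⊛-distribˡ , λ a b c → ⊛-distribʳ b c a
      }
    ; *-comm = ⊛-comm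
    }
  }

open CommutativeRing egf-commutativeRing using ()
  renaming (setoid to egf-setoid; refl to ≐-refl; sym to ≐-sym; +-cong to ⊕-cong; -‿cong to ⊖-cong)

cst-homomorphism : +-*-rawRing -Raw-AlmostCommutative⟶ fromCommutativeRing egf-commutativeRing
cst-homomorphism = record
  { ⟦_⟧    = cst
  ; +-homo = λ p q → λ { zero → refl ; (suc n) → refl }
  ; *-homo = λ p q → λ { zero → refl ; (suc n) → sym (trans (cst-⊛ p (cst q) (suc n)) (*-zeroʳ p)) }
  ; -‿homo = λ p → λ { zero → refl ; (suc n) → refl }
  ; 0-homo = λ { zero → refl ; (suc n) → refl }
  ; 1-homo = λ { zero → refl ; (suc n) → refl }
  }

cst-≟ : ∀ p q → Maybe (cst p ≐ cst q)
cst-≟ p q with p ≟ q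
... | yes refl = just λ _ → refl
... | no  _    = nothing

module EGF-Solver =
  Algebra.Solver.Ring +-*-rawRing (fromCommutativeRing egf-commutativeRing) cst-homomorphism cst-≟

-- scale t a is the series a (t z).
scale : ℚ → EGF → EGF
scale t a n = t ^ℚ n * a n

scale-cong : ∀ t {a b} → a ≐ b → scale t a ≐ scale t b
scale-cong t a≐b n = cong (t ^ℚ n *_) (a≐b n)

scale-⊕ : ∀ t a b → scale t (a ⊕ b) ≐ scale t a ⊕ scale t b
scale-⊕ t a b n = *-distribˡ-+ (t ^ℚ n) (a n) (b n)

scale-⊖ : ∀ t a → scale t (⊖ a) ≐ ⊖ scale t a
scale-⊖ t a n = sym (neg-distribʳ-* (t ^ℚ n) (a n))

scale-cst : ∀ t q → scale t (cst q) ≐ cst q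
scale-cst t q zero    = *-identityˡ q
scale-cst t q (suc n) = *-zeroʳ (t ^ℚ suc n)

scale-X : ∀ t → scale t X ≐ cst t ⊛ X
scale-X t n = trans (coefficients n) (sym (cst-⊛ t X n))
  where
  coefficients : ∀ n → scale t X n ≡ t * X n
  coefficients zero          = trans (*-zeroʳ 1ℚ) (sym (*-zeroʳ t))
  coefficients (suc zero)    = *-identityʳ (t * 1ℚ)
  coefficients (suc (suc n)) = trans (*-zeroʳ (t ^ℚ suc (suc n))) (sym (*-zeroʳ t))

∂-scale : ∀ t a → ∂ (scale t a) ≐ cst t ⊛ scale t (∂ a)
∂-scale t a n = trans (*-assoc t (t ^ℚ n) (a (suc n))) (sym (cst-⊛ t (scale t (∂ a)) n))

scale-⊛ : ∀ t a b → scale t (a ⊛ b) ≐ scale t a ⊛ scale t b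
scale-⊛ t a b zero    = solve 2 (λ x y → con 1ℚ :* (x :* y) := (con 1ℚ :* x) :* (con 1ℚ :* y)) refl (a 0) (b 0)
  where open +-*-Solver
scale-⊛ t a b (suc n) = begin
  t * t ^ℚ n * ((∂ a ⊛ b) n + (a ⊛ ∂ b) n)
    ≡⟨ *-assoc t (t ^ℚ n) _ ⟩
  t * scale t (∂ a ⊛ b ⊕ a ⊛ ∂ b) n
    ≡⟨ cong (t *_) (scale-⊕ t (∂ a ⊛ b) (a ⊛ ∂ b) n) ⟩
  t * (scale t (∂ a ⊛ b) n + scale t (a ⊛ ∂ b) n)
    ≡⟨ cong (t *_) (cong₂ _+_ (scale-⊛ t (∂ a) b n) (scale-⊛ t a (∂ b) n)) ⟩
  t * ((scale t (∂ a) ⊛ scale t b) n + (scale t a ⊛ scale t (∂ b)) n)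
    ≡⟨ cst-⊛ t (scale t (∂ a) ⊛ scale t b ⊕ scale t a ⊛ scale t (∂ b)) n ⟨
  (cst t ⊛ (scale t (∂ a) ⊛ scale t b ⊕ scale t a ⊛ scale t (∂ b))) n
    ≡⟨ solve 5 (λ c x y u v → c :* (x :* y :+ u :* v) := (c :* x) :* y :+ u :* (c :* v))
         ≐-refl (cst t) (scale t (∂ a)) (scale t b) (scale t a) (scale t (∂ b)) n ⟩
  ((cst t ⊛ scale t (∂ a)) ⊛ scale t b) n + (scale t a ⊛ (cst t ⊛ scale t (∂ b))) n
    ≡⟨ cong₂ _+_ (⊛-cong (≐-sym (∂-scale t a)) ≐-refl n)
                 (⊛-cong {a = scale t a} ≐-refl (≐-sym (∂-scale t b)) n) ⟩
  (∂ (scale t a) ⊛ scale t b) n + (scale t a ⊛ ∂ (scale t b)) n ∎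
  where
  open ≡-Reasoning
  open EGF-Solver

exp-⊛-exp : exp ⊛ exp ≐ scale (ℕ→ℚ 2) exp
exp-⊛-exp zero    = refl
exp-⊛-exp (suc n) = trans (cong₂ _+_ (exp-⊛-exp n) (exp-⊛-exp n))
  (solve 1 (λ x → x :* con 1ℚ :+ x :* con 1ℚ := (con (ℕ→ℚ 2) :* x) :* con 1ℚ) refl (ℕ→ℚ 2 ^ℚ n))
  where open +-*-Solver

scale-[-1]-exp-⊛-exp : scale (- 1ℚ) exp ⊛ exp ≐ 𝟙
scale-[-1]-exp-⊛-exp zero    = refl
scale-[-1]-exp-⊛-exp (suc n) = begin
  (∂ e⁻ ⊛ exp) n + (e⁻ ⊛ exp) n
    ≡⟨ cong (_+ (e⁻ ⊛ exp) n) (⊛-cong (∂-scale (- 1ℚ) exp) ≐-refl n) ⟩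
  ((cst (- 1ℚ) ⊛ e⁻) ⊛ exp) n + (e⁻ ⊛ exp) n
    ≡⟨ cong (_+ (e⁻ ⊛ exp) n) (trans (⊛-assoc (cst (- 1ℚ)) e⁻ exp n) (cst-⊛ (- 1ℚ) (e⁻ ⊛ exp) n)) ⟩
  - 1ℚ * (e⁻ ⊛ exp) n + (e⁻ ⊛ exp) n
    ≡⟨ solve 1 (λ x → con (- 1ℚ) :* x :+ x := con 0ℚ) refl ((e⁻ ⊛ exp) n) ⟩
  0ℚ ∎
  where
  open ≡-Reasoning
  open +-*-Solver
  e⁻ = scale (- 1ℚ) exp

⊛-exp-binomial : ∀ a n → (a ⊛ exp) n ≡ Σ[< suc n ] (λ j → ℕ→ℚ (n C j) * a j)
⊛-exp-binomial a zero    = trans (*-comm (a 0) 1ℚ) (sym (+-identityˡ (1ℚ * a 0)))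
⊛-exp-binomial a (suc n) = begin
  (∂ a ⊛ exp) n + (a ⊛ exp) n
    ≡⟨ cong₂ _+_ (⊛-exp-binomial (∂ a) n) (⊛-exp-binomial a n) ⟩
  S₁ + Σ[< suc n ] (λ j → ℕ→ℚ (n C j) * a j)
    ≡⟨ cong (S₁ +_) (Σ[<]-shift n (λ j → ℕ→ℚ (n C j) * a j)) ⟩
  S₁ + (1ℚ * a 0 + Σ[< n ] (λ j → ℕ→ℚ (n C suc j) * a (suc j)))
    ≡⟨ cong (λ s → S₁ + (1ℚ * a 0 + s)) top-term-vanishes ⟩
  S₁ + (1ℚ * a 0 + S₂)
    ≡⟨ +-CS.x∙yz≈y∙xz S₁ (1ℚ * a 0) S₂ ⟩
  1ℚ * a 0 + (S₁ + S₂)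
    ≡⟨ cong (1ℚ * a 0 +_) (Σ[<]-+ (suc n) _ _) ⟨
  1ℚ * a 0 + Σ[< suc n ] (λ j → ℕ→ℚ (n C j) * a (suc j) + ℕ→ℚ (n C suc j) * a (suc j))
    ≡⟨ cong (1ℚ * a 0 +_) (Σ[<]-cong (suc n) (λ j → pascal j (a (suc j)))) ⟩
  1ℚ * a 0 + Σ[< suc n ] (λ j → ℕ→ℚ (suc n C suc j) * a (suc j))
    ≡⟨ Σ[<]-shift (suc n) (λ j → ℕ→ℚ (suc n C j) * a j) ⟨
  Σ[< suc (suc n) ] (λ j → ℕ→ℚ (suc n C j) * a j) ∎
  where
  open ≡-Reasoning
  S₁ = Σ[< suc n ] (λ j → ℕ→ℚ (n C j) * a (suc j))
  S₂ = Σ[< suc n ] (λ j → ℕ→ℚ (n C suc j) * a (suc j))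

  top-term-vanishes : Σ[< n ] (λ j → ℕ→ℚ (n C suc j) * a (suc j)) ≡ S₂
  top-term-vanishes = sym (begin
    Σ[< n ] g + ℕ→ℚ (n C suc n) * a (suc n)  ≡⟨ cong (λ c → Σ[< n ] g + ℕ→ℚ c * a (suc n)) (k>n⇒nCk≡0 (ℕₚ.n<1+n n)) ⟩
    Σ[< n ] g + 0ℚ * a (suc n)               ≡⟨ cong (Σ[< n ] g +_) (*-zeroˡ (a (suc n))) ⟩
    Σ[< n ] g + 0ℚ                           ≡⟨ +-identityʳ (Σ[< n ] g) ⟩
    Σ[< n ] g                                ∎)
    where g = λ j → ℕ→ℚ (n C suc j) * a (suc j)

  pascal : ∀ j x → ℕ→ℚ (n C j) * x + ℕ→ℚ (n C suc j) * x ≡ ℕ→ℚ (suc n C suc j) * x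
  pascal j x = trans (sym (*-distribʳ-+ x (ℕ→ℚ (n C j)) (ℕ→ℚ (n C suc j))))
    (cong (_* x) (trans (sym (ℕ→ℚ-+ (n C j) (n C suc j))) (cong ℕ→ℚ (nCk+nC[k+1]≡[n+1]C[k+1] n j))))

⊛-exp-binomial′ : ∀ a n → (a ⊛ exp) n ≡ Σ[< n ] (λ j → ℕ→ℚ (n C j) * a j) + a n
⊛-exp-binomial′ a n = trans (⊛-exp-binomial a n)
  (cong (Σ[< n ] (λ j → ℕ→ℚ (n C j) * a j) +_)
    (trans (cong (λ c → ℕ→ℚ c * a n) (nCn≡1 n)) (*-identityˡ (a n))))

-- Reading a ⊛ exp ≐ a at degree n gives Σ_{j<n} (n C j) aⱼ = 0; at degree n + 1 the
-- lower coefficients vanish inductively and only (n + 1) aₙ is left.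
⊛-exp-fixed⇒𝟘 : ∀ a → a ⊛ exp ≐ a → a ≐ 𝟘
⊛-exp-fixed⇒𝟘 a fixed = <-rec (λ n → a n ≡ 0ℚ) step
  where
  open ≡-Reasoning

  lower-sum : ∀ n → Σ[< n ] (λ j → ℕ→ℚ (n C j) * a j) ≡ 0ℚ
  lower-sum n = identityˡ-unique _ (a n) (trans (sym (⊛-exp-binomial′ a n)) (fixed n))

  step : ∀ n → (∀ {j} → j < n → a j ≡ 0ℚ) → a n ≡ 0ℚ
  step n ih = trans (/ℕ-unique (suc n) top-coefficient) (*-zeroˡ (ℤ.+ 1 / suc n))
    where
    top-coefficient : ℕ→ℚ (suc n) * a n ≡ 0ℚ
    top-coefficient = begin
      ℕ→ℚ (suc n) * a n
        ≡⟨ cong (λ c → ℕ→ℚ c * a n) ([1+n]Cn≡1+n n) ⟨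
      ℕ→ℚ (suc n C n) * a n
        ≡⟨ +-identityˡ _ ⟨
      0ℚ + ℕ→ℚ (suc n C n) * a n
        ≡⟨ cong (_+ ℕ→ℚ (suc n C n) * a n)
             (Σ[<]-zero n (λ j j<n → trans (cong (ℕ→ℚ (suc n C j) *_) (ih j<n)) (*-zeroʳ (ℕ→ℚ (suc n C j))))) ⟨
      Σ[< suc n ] (λ j → ℕ→ℚ (suc n C j) * a j)
        ≡⟨ lower-sum (suc n) ⟩
      0ℚ ∎

⊛-[exp-1]-cancelʳ : ∀ a b → a ⊛ (exp ⊕ ⊖ 𝟙) ≐ b ⊛ (exp ⊕ ⊖ 𝟙) → a ≐ b
⊛-[exp-1]-cancelʳ a b eq n = x∙y⁻¹≈ε⇒x≈y (a n) (b n) (⊛-exp-fixed⇒𝟘 (a ⊕ ⊖ b) difference-fixed n)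
  where
  open Relation.Binary.Reasoning.Setoid egf-setoid
  open EGF-Solver
  difference-fixed : (a ⊕ ⊖ b) ⊛ exp ≐ a ⊕ ⊖ b
  difference-fixed = begin
    (a ⊕ ⊖ b) ⊛ exp
      ≈⟨ solve 3 (λ a b e → (a :- b) :* e := (a :- b) :+ (a :* (e :- con 1ℚ) :- b :* (e :- con 1ℚ)))
           ≐-refl a b exp ⟩
    (a ⊕ ⊖ b) ⊕ (a ⊛ (exp ⊕ ⊖ 𝟙) ⊕ ⊖ (b ⊛ (exp ⊕ ⊖ 𝟙)))
      ≈⟨ ⊕-cong {x = a ⊕ ⊖ b} ≐-refl (⊕-cong eq ≐-refl) ⟩
    (a ⊕ ⊖ b) ⊕ (b ⊛ (exp ⊕ ⊖ 𝟙) ⊕ ⊖ (b ⊛ (exp ⊕ ⊖ 𝟙)))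
      ≈⟨ solve 3 (λ a b c → (a :- b) :+ (c :- c) := a :- b) ≐-refl a b (b ⊛ (exp ⊕ ⊖ 𝟙)) ⟩
    a ⊕ ⊖ b ∎

scale-⊛-[exp-1] : ∀ t {a} → a ⊛ (exp ⊕ ⊖ 𝟙) ≐ X → scale t a ⊛ (scale t exp ⊕ ⊖ 𝟙) ≐ cst t ⊛ X
scale-⊛-[exp-1] t {a} a[exp-1]≐X = begin
  scale t a ⊛ (scale t exp ⊕ ⊖ 𝟙)      ≈⟨ ⊛-cong {a = scale t a} ≐-refl scale-[exp-1] ⟨
  scale t a ⊛ scale t (exp ⊕ ⊖ 𝟙)      ≈⟨ scale-⊛ t a (exp ⊕ ⊖ 𝟙) ⟨
  scale t (a ⊛ (exp ⊕ ⊖ 𝟙))            ≈⟨ scale-cong t a[exp-1]≐X ⟩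
  scale t X                            ≈⟨ scale-X t ⟩
  cst t ⊛ X                            ∎
  where
  open Relation.Binary.Reasoning.Setoid egf-setoid
  scale-[exp-1] : scale t (exp ⊕ ⊖ 𝟙) ≐ scale t exp ⊕ ⊖ 𝟙
  scale-[exp-1] n = trans (scale-⊕ t exp (⊖ 𝟙) n)
    (cong (scale t exp n +_) (trans (scale-⊖ t 𝟙 n) (cong -_ (scale-cst t 1ℚ n))))

-- The Bernoulli generating function

bernList≡applyUpTo : ∀ n → bernList n ≡ applyUpTo bernoulli n
bernList≡applyUpTo zero    = refl
bernList≡applyUpTo (suc n) = begin
  reverse (bernoulli n ∷ reverse (bernList n))   ≡⟨ Listₚ.unfold-reverse (bernoulli n) (reverse (bernList n)) ⟩
  reverse (reverse (bernList n)) ∷ʳ bernoulli n  ≡⟨ cong (_∷ʳ bernoulli n) (Listₚ.reverse-involutive (bernList n)) ⟩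
  bernList n ∷ʳ bernoulli n                      ≡⟨ cong (_∷ʳ bernoulli n) (bernList≡applyUpTo n) ⟩
  applyUpTo bernoulli n ∷ʳ bernoulli n           ≡⟨ Listₚ.applyUpTo-∷ʳ bernoulli n ⟩
  applyUpTo bernoulli (suc n)                    ∎
  where open ≡-Reasoning

bernoulli-suc : ∀ m →
  bernoulli (suc m) ≡ - (Σ[< suc m ] (λ j → ℕ→ℚ (suc (suc m) C j) * bernoulli j) /ℕ suc (suc m))
bernoulli-suc m = cong (λ s → - (s /ℕ suc (suc m))) (begin
  foldr _+_ 0ℚ (zipWith f (upTo (suc m)) (bernList (suc m)))
    ≡⟨ cong (λ bs → foldr _+_ 0ℚ (zipWith f (upTo (suc m)) bs)) (bernList≡applyUpTo (suc m)) ⟩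
  foldr _+_ 0ℚ (zipWith f (upTo (suc m)) (applyUpTo bernoulli (suc m)))
    ≡⟨ cong (foldr _+_ 0ℚ) (zipWith-applyUpTo f (λ j → j) bernoulli (suc m)) ⟩
  foldr _+_ 0ℚ (applyUpTo (λ j → f j (bernoulli j)) (suc m))
    ≡⟨ foldr-+-applyUpTo (λ j → f j (bernoulli j)) (suc m) ⟩
  Σ[< suc m ] (λ j → ℕ→ℚ (suc (suc m) C j) * bernoulli j) ∎)
  where
  open ≡-Reasoning
  f = λ j b → ℕ→ℚ (suc (suc m) C j) * b

bernoulli-recurrence : ∀ n → Σ[< n ] (λ j → ℕ→ℚ (n C j) * bernoulli j) ≡ X n
bernoulli-recurrence zero          = refl
bernoulli-recurrence (suc zero)    = refl
bernoulli-recurrence (suc (suc m)) = begin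
  s + ℕ→ℚ (suc (suc m) C suc m) * bernoulli (suc m)
    ≡⟨ cong₂ (λ c b → s + ℕ→ℚ c * b) ([1+n]Cn≡1+n (suc m)) (bernoulli-suc m) ⟩
  s + ℕ→ℚ (suc (suc m)) * - (s /ℕ suc (suc m))
    ≡⟨ cong (s +_) (trans (sym (neg-distribʳ-* (ℕ→ℚ (suc (suc m))) (s /ℕ suc (suc m)))) (cong -_ (ℕ→ℚ-*-/ℕ (suc (suc m)) s))) ⟩
  s + - s
    ≡⟨ +-inverseʳ s ⟩
  0ℚ ∎
  where
  open ≡-Reasoning
  s = Σ[< suc m ] (λ j → ℕ→ℚ (suc (suc m) C j) * bernoulli j)

bernoulli-egf : bernoulli ⊛ (exp ⊕ ⊖ 𝟙) ≐ X
bernoulli-egf n = begin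
  (bernoulli ⊛ (exp ⊕ ⊖ 𝟙)) n
    ≡⟨ E.solve 2 (λ b e → b E.:* (e E.:- E.con 1ℚ) E.:= b E.:* e E.:- b) ≐-refl bernoulli exp n ⟩
  (bernoulli ⊛ exp) n - bernoulli n
    ≡⟨ cong (_- bernoulli n) (⊛-exp-binomial′ bernoulli n) ⟩
  s + bernoulli n - bernoulli n
    ≡⟨ solve 2 (λ s b → s :+ b :- b := s) refl s (bernoulli n) ⟩
  s
    ≡⟨ bernoulli-recurrence n ⟩
  X n ∎
  where
  open ≡-Reasoning
  open +-*-Solver
  module E = EGF-Solver
  s = Σ[< n ] (λ j → ℕ→ℚ (n C j) * bernoulli j)

-- B(-z) (e^{-z} - 1) = -z, and multiplying by e^z turns this into B(-z) (e^z - 1) = z e^z.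
bernoulli-reflection : scale (- 1ℚ) bernoulli ≐ X ⊕ bernoulli
bernoulli-reflection = ⊛-[exp-1]-cancelʳ (scale (- 1ℚ) bernoulli) (X ⊕ bernoulli) (begin
  R ⊛ (exp ⊕ ⊖ 𝟙)
    ≈⟨ solve 3 (λ r e e⁻ → r :* (e :- con 1ℚ) := :- (e :* (r :* (e⁻ :- con 1ℚ))) :+ r :* (e⁻ :* e :- con 1ℚ))
         ≐-refl R exp e⁻ ⟩
  ⊖ (exp ⊛ (R ⊛ (e⁻ ⊕ ⊖ 𝟙))) ⊕ R ⊛ (e⁻ ⊛ exp ⊕ ⊖ 𝟙)
    ≈⟨ ⊕-cong (⊖-cong (⊛-cong {a = exp} ≐-refl (scale-⊛-[exp-1] (- 1ℚ) bernoulli-egf)))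
              (⊛-cong {a = R} ≐-refl (⊕-cong scale-[-1]-exp-⊛-exp ≐-refl)) ⟩
  ⊖ (exp ⊛ (cst (- 1ℚ) ⊛ X)) ⊕ R ⊛ (𝟙 ⊕ ⊖ 𝟙)
    ≈⟨ solve 3 (λ e x r → :- (e :* (con (- 1ℚ) :* x)) :+ r :* (con 1ℚ :- con 1ℚ) := x :* (e :- con 1ℚ) :+ x)
         ≐-refl exp X R ⟩
  X ⊛ (exp ⊕ ⊖ 𝟙) ⊕ X
    ≈⟨ ⊕-cong {x = X ⊛ (exp ⊕ ⊖ 𝟙)} ≐-refl (≐-sym bernoulli-egf) ⟩
  X ⊛ (exp ⊕ ⊖ 𝟙) ⊕ bernoulli ⊛ (exp ⊕ ⊖ 𝟙)
    ≈⟨ ⊛-distribʳ X bernoulli (exp ⊕ ⊖ 𝟙) ⟨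
  (X ⊕ bernoulli) ⊛ (exp ⊕ ⊖ 𝟙) ∎)
  where
  open Relation.Binary.Reasoning.Setoid egf-setoid
  open EGF-Solver
  R  = scale (- 1ℚ) bernoulli
  e⁻ = scale (- 1ℚ) exp

bernoulli-odd : ∀ n → 1 ≤ n → bernoulli (suc (2 ℕ.* n)) ≡ 0ℚ
bernoulli-odd (suc n) _ = -x≡x⇒x≡0 b (begin
  - b                                       ≡⟨ cong -_ (*-identityˡ b) ⟨
  - (1ℚ * b)                                ≡⟨ neg-distribˡ-* 1ℚ b ⟩
  - 1ℚ * b                                  ≡⟨ cong (λ x → - 1ℚ * x * b) ([-1]^[2n]≡1 (suc n)) ⟨
  (- 1ℚ) ^ℚ suc (2 ℕ.* suc n) * b           ≡⟨ bernoulli-reflection (suc (2 ℕ.* suc n)) ⟩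
  0ℚ + b                                    ≡⟨ +-identityˡ b ⟩
  b                                         ∎)
  where
  open ≡-Reasoning
  b = bernoulli (suc (2 ℕ.* suc n))

bernoulliDiff : EGF
bernoulliDiff = bernoulli ⊕ ⊖ scale (ℕ→ℚ 2) bernoulli

-- Both sides times e^z - 1 are z (e^z - 1): use e^{2z} - 1 = (e^z - 1)(e^z + 1) and B(2z)(e^{2z} - 1) = 2z.
bernoulliDiff-egf : bernoulliDiff ⊛ (exp ⊕ 𝟙) ≐ X
bernoulliDiff-egf = ⊛-[exp-1]-cancelʳ (bernoulliDiff ⊛ (exp ⊕ 𝟙)) X (begin
  (bernoulli ⊕ ⊖ P) ⊛ (exp ⊕ 𝟙) ⊛ (exp ⊕ ⊖ 𝟙)
    ≈⟨ solve 3 (λ b p e → (b :- p) :* (e :+ con 1ℚ) :* (e :- con 1ℚ)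
                          := b :* (e :- con 1ℚ) :* (e :+ con 1ℚ) :- p :* (e :* e :- con 1ℚ))
         ≐-refl bernoulli P exp ⟩
  bernoulli ⊛ (exp ⊕ ⊖ 𝟙) ⊛ (exp ⊕ 𝟙) ⊕ ⊖ (P ⊛ (exp ⊛ exp ⊕ ⊖ 𝟙))
    ≈⟨ ⊕-cong (⊛-cong bernoulli-egf ≐-refl) (⊖-cong P[e²-1]≐2X) ⟩
  X ⊛ (exp ⊕ 𝟙) ⊕ ⊖ (cst (ℕ→ℚ 2) ⊛ X)
    ≈⟨ solve 2 (λ x e → x :* (e :+ con 1ℚ) :- con (ℕ→ℚ 2) :* x := x :* (e :- con 1ℚ)) ≐-refl X exp ⟩
  X ⊛ (exp ⊕ ⊖ 𝟙) ∎)
  where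
  open Relation.Binary.Reasoning.Setoid egf-setoid
  open EGF-Solver
  P = scale (ℕ→ℚ 2) bernoulli
  P[e²-1]≐2X : P ⊛ (exp ⊛ exp ⊕ ⊖ 𝟙) ≐ cst (ℕ→ℚ 2) ⊛ X
  P[e²-1]≐2X = begin
    P ⊛ (exp ⊛ exp ⊕ ⊖ 𝟙)                 ≈⟨ ⊛-cong {a = P} ≐-refl (⊕-cong exp-⊛-exp ≐-refl) ⟩
    P ⊛ (scale (ℕ→ℚ 2) exp ⊕ ⊖ 𝟙)         ≈⟨ scale-⊛-[exp-1] (ℕ→ℚ 2) bernoulli-egf ⟩
    cst (ℕ→ℚ 2) ⊛ X                       ∎

bernoulliDiff-recurrence : ∀ n →
  Σ[< n ] (λ i → ℕ→ℚ (n C i) * bernoulliDiff i) + bernoulliDiff n + bernoulliDiff n ≡ X n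
bernoulliDiff-recurrence n = begin
  Σ[< n ] (λ i → ℕ→ℚ (n C i) * bernoulliDiff i) + bernoulliDiff n + bernoulliDiff n
    ≡⟨ cong₂ _+_ (⊛-exp-binomial′ bernoulliDiff n) (trans (⊛-comm bernoulliDiff 𝟙 n) (⊛-identityˡ bernoulliDiff n)) ⟨
  (bernoulliDiff ⊛ exp) n + (bernoulliDiff ⊛ 𝟙) n
    ≡⟨ ⊛-distribˡ bernoulliDiff exp 𝟙 n ⟨
  (bernoulliDiff ⊛ (exp ⊕ 𝟙)) n
    ≡⟨ bernoulliDiff-egf n ⟩
  X n ∎
  where open ≡-Reasoning

-- The even Bernoulli numbers

summand : ℕ → ℕ → ℚ
summand k j = (ℕ→ℚ ((2 ℕ.* k ∸ 1) C (2 ℕ.* j ∸ 1)) * (ℕ→ℚ (2 ^ (2 ℕ.* j) ∸ 1) /ℕ j)) * bernoulli (2 ℕ.* j)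

even-term : ∀ k j → 1 ≤ j → ℕ→ℚ ((2 ℕ.* k) C (2 ℕ.* j)) * bernoulliDiff (2 ℕ.* j) ≡ - ℕ→ℚ k * summand k j
even-term k j@(suc _) 1≤j = begin
  c * (b + - (p * b))
    ≡⟨ solve 3 (λ c p b → c :* (b :+ :- (p :* b)) := :- (c :* (p :- con 1ℚ)) :* b) refl c p b ⟩
  - (c * (p - 1ℚ)) * b
    ≡⟨ cong (λ x → - (c * x) * b) (ℕ→ℚ-2^n∸1 (2 ℕ.* j)) ⟨
  - (c * x) * b
    ≡⟨ cong (λ y → - y * b) absorption ⟨
  - (ℕ→ℚ k * (c′ * (x /ℕ j))) * b
    ≡⟨ solve 3 (λ k y b → :- (k :* y) :* b := :- k :* (y :* b)) refl (ℕ→ℚ k) (c′ * (x /ℕ j)) b ⟩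
  - ℕ→ℚ k * summand k j ∎
  where
  open ≡-Reasoning
  open +-*-Solver
  b  = bernoulli (2 ℕ.* j)
  p  = ℕ→ℚ 2 ^ℚ (2 ℕ.* j)
  x  = ℕ→ℚ (2 ^ (2 ℕ.* j) ∸ 1)
  binom  = (2 ℕ.* k) C (2 ℕ.* j)
  binom′ = (2 ℕ.* k ∸ 1) C (2 ℕ.* j ∸ 1)
  c  = ℕ→ℚ binom
  c′ = ℕ→ℚ binom′

  absorption : ℕ→ℚ k * (c′ * (x /ℕ j)) ≡ c * x
  absorption = begin
    ℕ→ℚ k * (c′ * (x /ℕ j))                              ≡⟨ *-assoc (ℕ→ℚ k) c′ (x /ℕ j) ⟨
    ℕ→ℚ k * c′ * (x /ℕ j)                                ≡⟨ cong (_* (x /ℕ j)) (ℕ→ℚ-* k binom′) ⟨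
    ℕ→ℚ (k ℕ.* binom′) * (x /ℕ j)                        ≡⟨ cong (λ n → ℕ→ℚ n * (x /ℕ j)) (j*[2k]C[2j]≡k*[2k-1]C[2j-1] k j 1≤j) ⟨
    ℕ→ℚ (j ℕ.* binom) * (x /ℕ j)                         ≡⟨ cong (_* (x /ℕ j)) (trans (ℕ→ℚ-* j binom) (*-comm (ℕ→ℚ j) c)) ⟩
    c * ℕ→ℚ j * (x /ℕ j)                                 ≡⟨ *-assoc c (ℕ→ℚ j) (x /ℕ j) ⟩
    c * (ℕ→ℚ j * (x /ℕ j))                               ≡⟨ cong (c *_) (ℕ→ℚ-*-/ℕ j x) ⟩
    c * x                                                ∎

bernoulliDiff-odd : ∀ n → 1 ≤ n → bernoulliDiff (suc (2 ℕ.* n)) ≡ 0ℚ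
bernoulliDiff-odd n 1≤n = begin
  b + - (p * b)         ≡⟨ cong (λ b → b + - (p * b)) (bernoulli-odd n 1≤n) ⟩
  0ℚ + - (p * 0ℚ)       ≡⟨ cong (λ y → 0ℚ + - y) (*-zeroʳ p) ⟩
  0ℚ                    ∎
  where
  open ≡-Reasoning
  b = bernoulli (suc (2 ℕ.* n))
  p = ℕ→ℚ 2 ^ℚ suc (2 ℕ.* n)

bernoulliDiff-binomial-even : ∀ m →
  Σ[< 2 ℕ.* suc m ] (λ i → ℕ→ℚ ((2 ℕ.* suc m) C i) * bernoulliDiff i)
    ≡ ℕ→ℚ (suc m) + - ℕ→ℚ (suc m) * Σ[1‥ m ] (summand (suc m))
bernoulliDiff-binomial-even m = begin
  Σ[< 2 ℕ.* k ] h                                         ≡⟨ Σ[<]-pairs k h ⟩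
  Σ[< k ] g                                               ≡⟨ Σ[<]-shift m g ⟩
  g 0 + Σ[< m ] (g ∘ suc)                                 ≡⟨ cong₂ _+_ lowest-pair (Σ[<]-cong m higher-pair) ⟩
  ℕ→ℚ k + Σ[< m ] (λ i → - ℕ→ℚ k * summand k (suc i))     ≡⟨ cong (ℕ→ℚ k +_) (Σ[<]-*-distribˡ m (- ℕ→ℚ k) (summand k ∘ suc)) ⟩
  ℕ→ℚ k + - ℕ→ℚ k * Σ[< m ] (summand k ∘ suc)             ≡⟨ cong (λ s → ℕ→ℚ k + - ℕ→ℚ k * s) (Σ[1‥]≡Σ[<] m (summand k)) ⟨
  ℕ→ℚ k + - ℕ→ℚ k * Σ[1‥ m ] (summand k)                  ∎
  where
  open ≡-Reasoning
  k = suc m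
  h = λ i → ℕ→ℚ ((2 ℕ.* k) C i) * bernoulliDiff i
  g = λ i → h (2 ℕ.* i) + h (suc (2 ℕ.* i))

  -- bernoulliDiff 0 = 0 and bernoulliDiff 1 = 1/2 hold by computation.
  lowest-pair : h 0 + h 1 ≡ ℕ→ℚ k
  lowest-pair = begin
    h 0 + h 1                                       ≡⟨ +-identityˡ (h 1) ⟩
    ℕ→ℚ ((2 ℕ.* k) C 1) * bernoulliDiff 1           ≡⟨ cong (λ n → ℕ→ℚ n * bernoulliDiff 1) (nC1≡n (2 ℕ.* k)) ⟩
    ℕ→ℚ (2 ℕ.* k) * bernoulliDiff 1                 ≡⟨ cong (_* bernoulliDiff 1) (ℕ→ℚ-* 2 k) ⟩
    ℕ→ℚ 2 * ℕ→ℚ k * bernoulliDiff 1                 ≡⟨ solve 1 (λ x → con (ℕ→ℚ 2) :* x :* con (bernoulliDiff 1) := x) refl (ℕ→ℚ k) ⟩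
    ℕ→ℚ k                                           ∎
    where open +-*-Solver

  higher-pair : ∀ i → g (suc i) ≡ - ℕ→ℚ k * summand k (suc i)
  higher-pair i = begin
    h (2 ℕ.* suc i) + h (suc (2 ℕ.* suc i))
      ≡⟨ cong₂ _+_ (even-term k (suc i) (ℕ.s≤s ℕ.z≤n))
                   (cong (ℕ→ℚ ((2 ℕ.* k) C suc (2 ℕ.* suc i)) *_) (bernoulliDiff-odd (suc i) (ℕ.s≤s ℕ.z≤n))) ⟩
    - ℕ→ℚ k * summand k (suc i) + ℕ→ℚ ((2 ℕ.* k) C suc (2 ℕ.* suc i)) * 0ℚ
      ≡⟨ cong (- ℕ→ℚ k * summand k (suc i) +_) (*-zeroʳ (ℕ→ℚ ((2 ℕ.* k) C suc (2 ℕ.* suc i)))) ⟩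
    - ℕ→ℚ k * summand k (suc i) + 0ℚ
      ≡⟨ +-identityʳ (- ℕ→ℚ k * summand k (suc i)) ⟩
    - ℕ→ℚ k * summand k (suc i) ∎

bernoulli-even-equation : ∀ m →
  ℕ→ℚ (2 ℕ.* (2 ^ (2 ℕ.* suc m) ∸ 1)) * bernoulli (2 ℕ.* suc m) ≡ ℕ→ℚ (suc m) * (1ℚ - Σ[1‥ m ] (summand (suc m)))
bernoulli-even-equation m = begin
  ℕ→ℚ (2 ℕ.* (2 ^ (2 ℕ.* k) ∸ 1)) * b
    ≡⟨ cong (_* b) (trans (ℕ→ℚ-* 2 (2 ^ (2 ℕ.* k) ∸ 1)) (cong (ℕ→ℚ 2 *_) (ℕ→ℚ-2^n∸1 (2 ℕ.* k)))) ⟩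
  ℕ→ℚ 2 * (p - 1ℚ) * b
    ≡⟨ solve 4 (λ K S b p → con (ℕ→ℚ 2) :* (p :- con 1ℚ) :* b
                := K :* (con 1ℚ :- S) :- (K :+ :- K :* S :+ (b :+ :- (p :* b)) :+ (b :+ :- (p :* b))))
         refl (ℕ→ℚ k) S b p ⟩
  ℕ→ℚ k * (1ℚ - S) - (ℕ→ℚ k + - ℕ→ℚ k * S + bernoulliDiff (2 ℕ.* k) + bernoulliDiff (2 ℕ.* k))
    ≡⟨ cong (λ z → ℕ→ℚ k * (1ℚ - S) - z) recurrence-at-2k ⟩
  ℕ→ℚ k * (1ℚ - S) - 0ℚ
    ≡⟨ +-identityʳ (ℕ→ℚ k * (1ℚ - S)) ⟩
  ℕ→ℚ k * (1ℚ - S) ∎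
  where
  open ≡-Reasoning
  open +-*-Solver
  k = suc m
  b = bernoulli (2 ℕ.* k)
  p = ℕ→ℚ 2 ^ℚ (2 ℕ.* k)
  S = Σ[1‥ m ] (summand k)

  recurrence-at-2k : ℕ→ℚ k + - ℕ→ℚ k * S + bernoulliDiff (2 ℕ.* k) + bernoulliDiff (2 ℕ.* k) ≡ 0ℚ
  recurrence-at-2k = begin
    ℕ→ℚ k + - ℕ→ℚ k * S + bernoulliDiff (2 ℕ.* k) + bernoulliDiff (2 ℕ.* k)
      ≡⟨ cong (λ z → z + bernoulliDiff (2 ℕ.* k) + bernoulliDiff (2 ℕ.* k)) (bernoulliDiff-binomial-even m) ⟨
    Σ[< 2 ℕ.* k ] (λ i → ℕ→ℚ ((2 ℕ.* k) C i) * bernoulliDiff i) + bernoulliDiff (2 ℕ.* k) + bernoulliDiff (2 ℕ.* k)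
      ≡⟨ bernoulliDiff-recurrence (2 ℕ.* k) ⟩
    X (2 ℕ.* k)
      ≡⟨ cong X (ℕₚ.*-suc 2 m) ⟩
    0ℚ ∎

mainTheorem12 : (k : ℕ) → 1 ≤ k →
    bernoulli (2 ℕ.* k)
      ≡ (ℕ→ℚ k /ℕ (2 ℕ.* (2 ^ (2 ℕ.* k) ∸ 1)))
        * (1ℚ - Σ[1‥ k ∸ 1 ] (λ j →
             (ℕ→ℚ ((2 ℕ.* k ∸ 1) C (2 ℕ.* j ∸ 1)) * (ℕ→ℚ (2 ^ (2 ℕ.* j) ∸ 1) /ℕ j))
               * bernoulli (2 ℕ.* j)))
mainTheorem12 k@(suc m) _ = begin
  bernoulli (2 ℕ.* k)                    ≡⟨ /ℕ-unique D (bernoulli-even-equation m) ⟩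
  (ℕ→ℚ k * (1ℚ - S)) /ℕ D                ≡⟨ *-/ℕ D (ℕ→ℚ k) (1ℚ - S) ⟩
  (ℕ→ℚ k /ℕ D) * (1ℚ - S)                ∎
  where
  open ≡-Reasoning
  D = 2 ℕ.* (2 ^ (2 ℕ.* k) ∸ 1)
  S = Σ[1‥ m ] (summand k)
  instance
    D≢0 : NonZero D
    D≢0 = >-nonZero (ℕₚ.*-monoʳ-< 2 (ℕₚ.m<n⇒0<n∸m (ℕₚ.^-monoʳ-< 2 (ℕₚ.n<1+n 1) {0} {2 ℕ.* k} ℕ.z<s)))
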